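{- Let $n = 2\uparrow\uparrow 18$, and suppose the edges of the complete graph on $\{\pm1\}^n$ are $2$-colored so that all parallel edges receive the same color (i.e., the color of the edge $\{x,y\}$ depends only on the vector $\pm(y-x)$). Then there exist four points forming a $2$-dimensional subcube of $\{\pm1\}^n$ such that all $6$ edges between them have the same color.
   Context: A $2$-dimensional subcube of $\{\pm1\}^n$ is the image of an injective map $f:\{\pm1\}^2\to\{\pm1\}^n$ each of whose coordinates $f_i(x_1,x_2)$ is either a constant $\pm1$ or $\pm x_j$ for some $j\in\{1,2\}$ (a planar $K_4$). Knuth up-arrow notation: $a\uparrow\uparrow b$ is the right-associated tower $a^{a^{\cdot^{\cdot^{a}}}}$ with $b$ copies of $a$. -}

module Defs where

open import Data.Nat using (ℕ; zero; suc; _^_)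
open import Data.Fin using (Fin)
import Data.Fin as Fin
open import Data.Sign using (Sign) renaming (+ to pos; - to neg)
open import Data.Integer using (ℤ; _-_; -_; -[1+_]) renaming (+_ to ℤ+)
open import Data.Product using (_×_; _,_; proj₁; proj₂; Σ; ∃)
open import Relation.Binary.PropositionalEquality using (_≡_)
open import Relation.Nullary using (¬_)
open import Data.Sum using (_⊎_)

_↑↑_ : ℕ → ℕ → ℕ
a ↑↑ zero = 1
a ↑↑ suc b = a ^ (a ↑↑ b)

Point : ℕ → Set
Point n = Fin n → Sign

val : Sign → ℤ
val pos = ℤ+ 1
val neg = -[1+ 0 ]

diff : ∀ {n} → Point n → Point n → Fin n → ℤ
diff x y i = val (y i) - val (x i)

_≈P_ : ∀ {n} → Point n → Point n → Set
x ≈P y = ∀ i → x i ≡ y i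

-- A 2-colouring of the edges of the complete graph on {±1}^n, given on
-- ordered pairs (values on pairs x = y are irrelevant).
Colouring : ℕ → Set
Colouring n = Point n → Point n → Fin 2

ParallelInvariant : ∀ {n} → Colouring n → Set
ParallelInvariant {n} χ =
  ∀ (x y x' y' : Point n) → ¬ (x ≈P y) → ¬ (x' ≈P y') →
  ((∀ i → diff x y i ≡ diff x' y' i) ⊎ (∀ i → diff x y i ≡ - diff x' y' i)) →
  χ x y ≡ χ x' y'

Sq : Set
Sq = Sign × Sign

_·_ : Sign → Sign → Sign
pos · s = s
neg · pos = neg
neg · neg = pos

-- A coordinate function of a subcube map: a constant ±1, or ±x_j (j ∈ {1,2})
data CoordFun : Set where
  const : Sign → CoordFun
  var   : Sign → Fin 2 → CoordFun

evalCoord : CoordFun → Sq → Sign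
evalCoord (const s) _ = s
evalCoord (var s Fin.zero) (a , b) = s · a
evalCoord (var s (Fin.suc _)) (a , b) = s · b

subcubeMap : ∀ {n} → (Fin n → CoordFun) → Sq → Point n
subcubeMap φ p i = evalCoord (φ i) p

Injective₂ : ∀ {n} → (Sq → Point n) → Set
Injective₂ f = ∀ p q → f p ≈P f q → p ≡ q

-- A word of five moves (stay, rise, fall) placed on coordinates s₀ < ⋯ < s₄ is the edge direction
-- that is constant on each block [sᵢ, sᵢ₊₁) with the i-th letter, and stays before s₀; giving each
-- 5-set of coordinates the colour of that edge yields one colouring for each of seven fixed words.
-- The hypergraph Ramsey theorem (five rounds of Erdős–Rado stepping up, whence the tower) gives seven coordinates
-- y₀ < ⋯ < y₆ on which all seven colourings are constant, say with colours κ₀, …, κ₆. A square whose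
-- coordinate functions are constant on the blocks cut out by the yₖ has each of its six edges
-- parallel to some word placed on five of the yₖ; eight such squares, each using only words on which
-- κ agrees, cover all 2⁷ possible κ, and parallel invariance then makes the chosen square
-- monochromatic. Both finite facts about the eight squares are checked by evaluation.

module Submission where

open import Defs
open import Data.Nat using (ℕ)
open import Data.Fin using (Fin)
open import Data.Product using (Σ; ∃; _×_)
open import Relation.Binary.PropositionalEquality using (_≡_)
open import Relation.Nullary using (¬_)

open import Data.Bool using (Bool; true; false)
open import Data.Fin as Fin using (zero; suc; #_; toℕ; fromℕ<)
open import Data.Fin.Properties using (all?; any?; toℕ-fromℕ<)
open import Data.Integer as ℤ using (ℤ; -_) renaming (+_ to ℤ+)
open import Data.List
  using (List; []; _∷_; _++_; length; map; filter; upTo; allFin; cartesianProduct; initLast; _∷ʳ′_)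
open import Data.List.Properties
  using (length-++; length-map; length-tabulate; length-upTo; ++-assoc; ≡-dec)
open import Data.List.Membership.Propositional using (_∈_; find)
open import Data.List.Membership.Propositional.Properties
  using (∈-++⁺ˡ; ∈-++⁺ʳ; ∈-++⁻; ∈-map⁺; ∈-map⁻; ∈-cartesianProduct⁺; ∈-cartesianProduct⁻; ∈-allFin)
open import Data.List.Relation.Binary.Sublist.Propositional
  using (_⊆_; []; _∷_; _∷ʳ_; ⊆-refl; ⊆-trans; minimum)
open import Data.List.Relation.Binary.Sublist.Propositional.Properties
  using (All-resp-⊆; Any-resp-⊆; ∷ˡ⁻; ++⁺; ++⁺ʳ; filter-⊆)
open import Data.List.Relation.Unary.All as All using (All; []; _∷_)
open import Data.List.Relation.Unary.All.Properties using (all-filter; all-upTo)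
open import Data.List.Relation.Unary.AllPairs using (AllPairs; []; _∷_)
open import Data.List.Relation.Unary.AllPairs.Properties using (applyUpTo⁺₁)
open import Data.List.Relation.Unary.Any as Any using (Any; here)
open import Data.Nat
  using (zero; suc; _+_; _*_; _^_; _≤_; _<_; _≤′_; _≤?_; z≤n; s≤s; ≤′-refl; ≤′-step; >-nonZero)
open import Data.Nat.Properties
open import Data.Nat.Tactic.RingSolver using (solve-∀)
open import Data.Product using (_,_; proj₁; proj₂; ∃₂)
open import Data.Product.Properties using () renaming (≡-dec to ×-≡-dec)
open import Data.Sign using (Sign) renaming (+ to pos; - to neg)
import Data.Sign.Properties as Sign
open import Data.Sum using (inj₁; inj₂)
open import Data.Vec as Vec using (Vec; []; _∷_; tabulate)
open import Data.Vec.Properties using (lookup∘tabulate)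
open import Function using (id; case_of_)
open import Relation.Binary.Definitions using (DecidableEquality)
open import Relation.Binary.PropositionalEquality
  using (_≢_; _≗_; refl; sym; trans; cong; cong₂; subst; module ≡-Reasoning)
open import Relation.Nullary using (Dec; yes; no; ¬?; contradiction)
open import Relation.Nullary.Decidable using (from-yes; map′; _×-dec_; _→-dec_)
open import Relation.Unary using (Decidable)

module _ {a} {A : Set a} where

  sublists : List A → List (List A)
  sublists []       = [] ∷ []
  sublists (x ∷ xs) = map (x ∷_) (sublists xs) ++ sublists xs

  ∈-sublists : ∀ {xs ys : List A} → xs ⊆ ys → xs ∈ sublists ys
  ∈-sublists []                     = here refl
  ∈-sublists {ys = y ∷ ys} (y ∷ʳ σ) = ∈-++⁺ʳ (map (y ∷_) (sublists ys)) (∈-sublists σ)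
  ∈-sublists (refl ∷ σ)             = ∈-++⁺ˡ (∈-map⁺ (_ ∷_) (∈-sublists σ))

  length-sublists : ∀ (xs : List A) → length (sublists xs) ≡ 2 ^ length xs
  length-sublists []       = refl
  length-sublists (x ∷ xs) = begin
    length (map (x ∷_) (sublists xs) ++ sublists xs)
      ≡⟨ length-++ (map (x ∷_) (sublists xs)) ⟩
    length (map (x ∷_) (sublists xs)) + length (sublists xs)
      ≡⟨ cong₂ _+_ (trans (length-map (x ∷_) (sublists xs)) (length-sublists xs))
                   (trans (length-sublists xs) (sym (+-identityʳ _))) ⟩
    2 ^ length (x ∷ xs) ∎
    where open ≡-Reasoning

  AllPairs-resp-⊆ : ∀ {r} {R : A → A → Set r} {xs ys} → xs ⊆ ys → AllPairs R ys → AllPairs R xs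
  AllPairs-resp-⊆ []         []       = []
  AllPairs-resp-⊆ (y ∷ʳ σ)   (_ ∷ rs) = AllPairs-resp-⊆ σ rs
  AllPairs-resp-⊆ (refl ∷ σ) (r ∷ rs) = All-resp-⊆ σ r ∷ AllPairs-resp-⊆ σ rs

  init-last : ∀ {n} (xs : List A) → suc n ≤ length xs →
              ∃₂ λ ys y → xs ≡ ys ++ y ∷ [] × n ≤ length ys
  init-last xs size with initLast xs
  init-last .[] () | []
  init-last .(ys ++ y ∷ []) size | ys ∷ʳ′ y =
    ys , y , refl , ≤-pred (subst (_ ≤_) (trans (length-++ ys) (+-comm (length ys) 1)) size)

module _ {a b} {A : Set a} {B : Set b} where

  length-cartesianProduct : ∀ (xs : List A) (ys : List B) →
                            length (cartesianProduct xs ys) ≡ length xs * length ys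
  length-cartesianProduct []       ys = refl
  length-cartesianProduct (x ∷ xs) ys = trans (length-++ (map (x ,_) ys))
    (cong₂ _+_ (length-map (x ,_) ys) (length-cartesianProduct xs ys))

module _ {a} {A : Set a} where

  Monochromatic : (A → Fin 2) → List A → Set a
  Monochromatic f X = ∃ λ b → All (λ x → f x ≡ b) X

  monochromatic? : ∀ (f : A → Fin 2) X → Dec (Monochromatic f X)
  monochromatic? f X = any? λ b → All.all? (λ x → f x Fin.≟ b) X

  Monochromatic-resp-⊆ : ∀ {f X Y} → Y ⊆ X → Monochromatic f X → Monochromatic f Y
  Monochromatic-resp-⊆ σ (b , fX≡b) = b , All-resp-⊆ σ fX≡b

  Monochromatic-resp-≗ : ∀ {f g X} → f ≗ g → Monochromatic f X → Monochromatic g X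
  Monochromatic-resp-≗ f≗g (b , fX≡b) = b , All.map (λ {x} fx≡b → trans (sym (f≗g x)) fx≡b) fX≡b

  colourClass : (A → Fin 2) → Fin 2 → List A → List A
  colourClass f b = filter (λ x → f x Fin.≟ b)

  length-colourClasses : ∀ f X →
    length (colourClass f zero X) + length (colourClass f (suc zero) X) ≡ length X
  length-colourClasses f []      = refl
  length-colourClasses f (x ∷ X) with f x
  ... | zero     = cong suc (length-colourClasses f X)
  ... | suc zero = trans (+-suc _ _) (cong suc (length-colourClasses f X))

  halve : ∀ (f : A → Fin 2) X {k} → 2 * k ≤ length X →
          ∃ λ Y → Y ⊆ X × k ≤ length Y × Monochromatic f Y
  halve f X {k} size with k ≤? length (colourClass f zero X) | k ≤? length (colourClass f (suc zero) X)
  ... | yes k≤₀ | _      = _ , filter-⊆ _ X , k≤₀ , zero , all-filter _ X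
  ... | no _   | yes k≤₁ = _ , filter-⊆ _ X , k≤₁ , suc zero , all-filter _ X
  ... | no k≰₀ | no k≰₁  = contradiction size (<⇒≱ (begin-strict
    length X
      ≡⟨ sym (length-colourClasses f X) ⟩
    length (colourClass f zero X) + length (colourClass f (suc zero) X)
      <⟨ +-mono-< (≰⇒> k≰₀) (≰⇒> k≰₁) ⟩
    k + k
      ≡⟨ cong (k +_) (sym (+-identityʳ k)) ⟩
    2 * k ∎))
    where open ≤-Reasoning

  refine : ∀ {i} {I : Set i} (ts : List I) (f : I → A → Fin 2) X {k} → 2 ^ length ts * k ≤ length X →
           ∃ λ Y → Y ⊆ X × k ≤ length Y × All (λ t → Monochromatic (f t) Y) ts
  refine [] f X {k} size = X , ⊆-refl , subst (_≤ length X) (+-identityʳ k) size , []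
  refine (t ∷ ts) f X {k} size with halve (f t) X (subst (_≤ length X) (*-assoc 2 (2 ^ length ts) k) size)
  ... | X₁ , X₁⊆X , size₁ , mono₁ with refine ts f X₁ size₁
  ... | Y , Y⊆X₁ , sizeY , monoY = Y , ⊆-trans Y⊆X₁ X₁⊆X , sizeY , Monochromatic-resp-⊆ Y⊆X₁ mono₁ ∷ monoY

-- Hypergraph Ramsey theorem

-- Extending an end-homogeneous sequence of length t by one element refines the pool once for
-- each of the L colourings and each of the 2 ^ t sublists of the sequence.
extendBound : ℕ → ℕ → ℕ → ℕ
extendBound L zero    t = 0
extendBound L (suc k) t = 2 ^ (2 ^ t * L) * suc (extendBound L k (suc t))

ramseyBound : ℕ → ℕ → ℕ → ℕ
ramseyBound L m zero    = m
ramseyBound L m (suc r) = extendBound L (suc (ramseyBound L m r)) 0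

module _ {a} {A : Set a} {L : ℕ} where

  Homogeneous : ℕ → (List A → Fin L → Fin 2) → List A → (Fin L → Fin 2) → Set a
  Homogeneous r c Y κ = ∀ {S} → S ⊆ Y → length S ≡ r → ∀ j → c S j ≡ κ j

  -- Chosen elements are kept most recent first, and each new one precedes the earlier ones
  -- in the ground list, so the head is the element whose choice must not matter.
  EndHomogeneous : (List A → Fin L → Fin 2) → List A → Set a
  EndHomogeneous c P = ∀ {w z S} → w ∷ z ∷ S ⊆ P → ∀ j → c (w ∷ S) j ≡ c (z ∷ S) j

  Extendable : (List A → Fin L → Fin 2) → List A → List A → Set a
  Extendable c P X = ∀ {z S w} → z ∷ S ⊆ P → w ∈ X → ∀ j → c (w ∷ S) j ≡ c (z ∷ S) j

  module _ {c : List A → Fin L → Fin 2} where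

    Extendable-resp-⊆ : ∀ {P X Y} → Y ⊆ X → Extendable c P X → Extendable c P Y
    Extendable-resp-⊆ Y⊆X ext θ w∈Y = ext θ (Any-resp-⊆ Y⊆X w∈Y)

    EndHomogeneous-∷ : ∀ {P X y} → Extendable c P X → y ∈ X → EndHomogeneous c P →
                       EndHomogeneous c (y ∷ P)
    EndHomogeneous-∷ ext y∈X eh (_ ∷ʳ θ)   = eh θ
    EndHomogeneous-∷ ext y∈X eh (refl ∷ θ) = ext θ y∈X

    Extendable-∷ : ∀ {P X y} → Extendable c P (X ++ y ∷ []) →
                   (∀ {S} → S ⊆ P → ∀ j → Monochromatic (λ w → c (w ∷ S) j) (X ++ y ∷ [])) →
                   Extendable c (y ∷ P) X
    Extendable-∷ ext mono (_ ∷ʳ θ) w∈X j = ext θ (∈-++⁺ˡ w∈X) j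
    Extendable-∷ {X = X} ext mono (refl ∷ θ) w∈X j with mono θ j
    ... | _ , c≡b = trans (All.lookup c≡b (∈-++⁺ˡ w∈X)) (sym (All.lookup c≡b (∈-++⁺ʳ X (here refl))))

    extend : ∀ k {P} X → extendBound L k (length P) ≤ length X →
             EndHomogeneous c P → Extendable c P X →
             ∃ λ Q → Q ⊆ X × length Q ≡ k × EndHomogeneous c (Q ++ P)
    extend zero    X _ eh _ = [] , minimum X , refl , eh
    extend (suc k) {P} X size eh ext with refine pairs (λ (S , j) w → c (w ∷ S) j) X pool-large
      where
        pairs = cartesianProduct (sublists P) (allFin L)
        pool-large : 2 ^ length pairs * suc (extendBound L k (suc (length P))) ≤ length X
        pool-large = subst (λ e → 2 ^ e * suc (extendBound L k (suc (length P))) ≤ length X)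
                  (sym (trans (length-cartesianProduct (sublists P) (allFin L))
                              (cong₂ _*_ (length-sublists P) (length-tabulate id))))
                  size
    ... | X₂ , X₂⊆X , size₂ , mono with init-last X₂ size₂
    ... | X′ , y , refl , sizeX′ with extend k {y ∷ P} X′ sizeX′ eh′ ext′
      where
        ext₂ = Extendable-resp-⊆ X₂⊆X ext
        eh′  = EndHomogeneous-∷ ext₂ (∈-++⁺ʳ X′ (here refl)) eh
        ext′ = Extendable-∷ ext₂ λ θ j → All.lookup mono (∈-cartesianProduct⁺ (∈-sublists θ) (∈-allFin j))
    ... | Q , Q⊆X′ , |Q| , ehQ =
      Q ++ y ∷ [] , ⊆-trans (++⁺ Q⊆X′ ⊆-refl) X₂⊆X ,
      trans (length-++ Q) (trans (+-comm (length Q) 1) (cong suc |Q|)) ,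
      subst (EndHomogeneous c) (sym (++-assoc Q (y ∷ []) P)) ehQ

  ramsey : ∀ m r (c : List A → Fin L → Fin 2) X → ramseyBound L m r ≤ length X →
           ∃ λ Y → Y ⊆ X × m ≤ length Y × ∃ (Homogeneous r c Y)
  ramsey m zero c X size = X , ⊆-refl , size , c [] , λ { {[]} _ _ _ → refl }
  ramsey m (suc r) c X size with extend {c = c} (suc (ramseyBound L m r)) {[]} X size (λ ()) (λ ())
  ... | y ∷ Q , y∷Q⊆X , |y∷Q| , eh with ramsey m r (λ S → c (y ∷ S)) Q (≤-reflexive (sym (suc-injective |y∷Q|)))
  ... | Y , Y⊆Q , sizeY , κ , hom = Y , ⊆-trans Y⊆Q (∷ˡ⁻ y∷Q⊆X) , sizeY , κ , hom′
    where
      hom′ : Homogeneous (suc r) c Y κ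
      hom′ {z ∷ S} θ |z∷S| j =
        trans (sym (eh (refl ∷ ++⁺ʳ [] (⊆-trans θ Y⊆Q)) j)) (hom (∷ˡ⁻ θ) (suc-injective |z∷S|) j)

-- The Ramsey bound below a tower of twos

n≤2^n : ∀ n → n ≤ 2 ^ n
n≤2^n zero    = z≤n
n≤2^n (suc n) = +-mono-≤ (m^n>0 2 n) (≤-trans (n≤2^n n) (≤-reflexive (sym (+-identityʳ (2 ^ n)))))

↑↑-mono : ∀ {h h′} → h ≤′ h′ → 2 ↑↑ h ≤ 2 ↑↑ h′
↑↑-mono ≤′-refl         = ≤-refl
↑↑-mono (≤′-step {h′} h≤h′) = ≤-trans (↑↑-mono h≤h′) (n≤2^n (2 ↑↑ h′))

extendBound-≤ : ∀ L k t → 2 ^ (2 ^ t * L) * suc (extendBound L k t) ≤ 2 ^ (2 ^ (k + t) * L + k)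
extendBound-≤ L zero    t =
  ≤-reflexive (trans (*-identityʳ (2 ^ (2 ^ t * L))) (cong (2 ^_) (sym (+-identityʳ (2 ^ t * L)))))
extendBound-≤ L (suc k) t = begin
  y * suc (y * s)                       ≤⟨ *-monoʳ-≤ y (+-monoˡ-≤ (y * s) ys-positive) ⟩
  y * (y * s + y * s)                   ≡⟨ double y s ⟩
  2 * (y * y * s)                       ≡⟨ cong (λ e → 2 * (e * s)) square ⟩
  2 * (2 ^ (2 ^ suc t * L) * s)         ≤⟨ *-monoʳ-≤ 2 (extendBound-≤ L k (suc t)) ⟩
  2 * 2 ^ (2 ^ (k + suc t) * L + k)     ≡⟨ cong (λ e → 2 ^ suc (2 ^ e * L + k)) (+-suc k t) ⟩
  2 ^ suc (2 ^ suc (k + t) * L + k)     ≡⟨ cong (2 ^_) (sym (+-suc (2 ^ suc (k + t) * L) k)) ⟩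
  2 ^ (2 ^ (suc k + t) * L + suc k)     ∎
  where
    open ≤-Reasoning
    y = 2 ^ (2 ^ t * L)
    s = suc (extendBound L k (suc t))
    ys-positive : 1 ≤ y * s
    ys-positive = *-mono-≤ (m^n>0 2 (2 ^ t * L)) (s≤s z≤n)
    double : ∀ y s → y * (y * s + y * s) ≡ 2 * (y * y * s)
    double = solve-∀
    twice : ∀ u L → u * L + u * L ≡ 2 * u * L
    twice = solve-∀
    square : y * y ≡ 2 ^ (2 ^ suc t * L)
    square = trans (sym (^-distribˡ-+-* 2 (2 ^ t * L) (2 ^ t * L))) (cong (2 ^_) (twice (2 ^ t) L))

suc-extendBound-≤ : ∀ L M → suc (extendBound L M 0) ≤ 2 ^ (2 ^ M * L + M)
suc-extendBound-≤ L M = begin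
  suc (extendBound L M 0)                     ≤⟨ m≤n*m _ (2 ^ (1 * L)) {{>-nonZero (m^n>0 2 (1 * L))}} ⟩
  2 ^ (1 * L) * suc (extendBound L M 0)       ≤⟨ extendBound-≤ L M 0 ⟩
  2 ^ (2 ^ (M + 0) * L + M)                   ≡⟨ cong (λ e → 2 ^ (2 ^ e * L + M)) (+-identityʳ M) ⟩
  2 ^ (2 ^ M * L + M)                         ∎
  where open ≤-Reasoning

ramseyBound-+8 : ∀ r → ramseyBound 7 7 r + 8 ≤ 2 ↑↑ (3 + r * 2)
ramseyBound-+8 zero    = m≤m+n 15 1
ramseyBound-+8 (suc r) = begin
  E + 8                          ≤⟨ ≤-trans (m≤m+n (E + 8) (7 * E)) (≤-reflexive (eight E)) ⟩
  8 * suc E                      ≤⟨ *-monoʳ-≤ 8 (suc-extendBound-≤ 7 M) ⟩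
  2 ^ 3 * 2 ^ (2 ^ M * 7 + M)    ≡⟨ sym (^-distribˡ-+-* 2 3 (2 ^ M * 7 + M)) ⟩
  2 ^ (3 + (2 ^ M * 7 + M))      ≤⟨ ^-monoʳ-≤ 2 exponent-≤ ⟩
  2 ^ 2 ^ 2 ↑↑ (3 + r * 2)       ∎
  where
    open ≤-Reasoning
    R = ramseyBound 7 7 r
    M = suc R
    E = extendBound 7 M 0
    eight : ∀ e → e + 8 + 7 * e ≡ 8 * suc e
    eight = solve-∀
    eleven : ∀ x → 3 * x + (x * 7 + x) ≡ x * 11
    eleven = solve-∀
    exponent-≤ : 3 + (2 ^ M * 7 + M) ≤ 2 ^ 2 ↑↑ (3 + r * 2)
    exponent-≤ = begin
      3 + (2 ^ M * 7 + M)         ≤⟨ +-mono-≤ (*-monoʳ-≤ 3 (m^n>0 2 M)) (+-monoʳ-≤ (2 ^ M * 7) (n≤2^n M)) ⟩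
      3 * 2 ^ M + (2 ^ M * 7 + 2 ^ M) ≡⟨ eleven (2 ^ M) ⟩
      2 ^ M * 11                  ≤⟨ *-monoʳ-≤ (2 ^ M) (m≤m+n 11 5) ⟩
      2 ^ M * 2 ^ 4               ≡⟨ sym (^-distribˡ-+-* 2 M 4) ⟩
      2 ^ (M + 4)                 ≤⟨ ^-monoʳ-≤ 2 (≤-trans (≤-reflexive (sym (+-suc R 4)))
                                       (≤-trans (+-monoʳ-≤ R (m≤m+n 5 3)) (ramseyBound-+8 r))) ⟩
      2 ^ 2 ↑↑ (3 + r * 2)        ∎

ramseyBound-≤-↑↑ : ∀ {r h} → 3 + r * 2 ≤′ h → ramseyBound 7 7 r ≤ 2 ↑↑ h
ramseyBound-≤-↑↑ {r} h-large = ≤-trans (m≤m+n _ 8) (≤-trans (ramseyBound-+8 r) (↑↑-mono h-large))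

data Move : Set where
  stay rise fall : Move

_≟ₘ_ : DecidableEquality Move
stay ≟ₘ stay = yes refl
stay ≟ₘ rise = no λ ()
stay ≟ₘ fall = no λ ()
rise ≟ₘ stay = no λ ()
rise ≟ₘ rise = yes refl
rise ≟ₘ fall = no λ ()
fall ≟ₘ stay = no λ ()
fall ≟ₘ rise = no λ ()
fall ≟ₘ fall = yes refl

move : Sign → Sign → Move
move pos pos = stay
move neg neg = stay
move neg pos = rise
move pos neg = fall

source target : Move → Sign
source stay = pos
source rise = neg
source fall = pos
target stay = pos
target rise = pos
target fall = neg

flip : Move → Move
flip stay = stay
flip rise = fall
flip fall = rise

orient : Bool → Move → Move
orient true  m = m
orient false m = flip m

displacement : Move → ℤ
displacement stay = ℤ+ 0
displacement rise = ℤ+ 2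
displacement fall = - ℤ+ 2

move-source-target : ∀ m → move (source m) (target m) ≡ m
move-source-target stay = refl
move-source-target rise = refl
move-source-target fall = refl

move-self : ∀ s → move s s ≡ stay
move-self pos = refl
move-self neg = refl

displacement-move : ∀ x y → val y ℤ.- val x ≡ displacement (move x y)
displacement-move pos pos = refl
displacement-move pos neg = refl
displacement-move neg pos = refl
displacement-move neg neg = refl

displacement-flip : ∀ m → displacement (flip m) ≡ - displacement m
displacement-flip stay = refl
displacement-flip rise = refl
displacement-flip fall = refl

orient-≢-stay : ∀ s {m} → m ≢ stay → orient s m ≢ stay
orient-≢-stay true  m≢stay = m≢stay
orient-≢-stay false {stay} m≢stay = m≢stay
orient-≢-stay false {rise} _ ()
orient-≢-stay false {fall} _ ()

moves : ∀ {n} → Point n → Point n → Fin n → Move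
moves x y i = move (x i) (y i)

moves-≢-stay : ∀ {n} {x y : Point n} i → moves x y i ≢ stay → ¬ x ≈P y
moves-≢-stay {x = x} i moves≢stay x≈y = moves≢stay (trans (cong (move (x i)) (sym (x≈y i))) (move-self (x i)))

moveAlong : Sq → Sq → CoordFun → Move
moveAlong a b t = move (evalCoord t a) (evalCoord t b)

step : ∀ {b} {B : Set b} → B → List ℕ → List B → ℕ → B
step v (y ∷ Y) (w ∷ ws) i with y ≤? i
... | yes _ = step w Y ws i
... | no  _ = v
step v _       _        i = v

module _ {b} {B : Set b} where

  step-map : ∀ {c} {C : Set c} (f : B → C) v Y ws i → f (step v Y ws i) ≡ step (f v) Y (map f ws) i
  step-map f v []      ws       i = refl
  step-map f v (y ∷ Y) []       i = refl
  step-map f v (y ∷ Y) (w ∷ ws) i with y ≤? i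
  ... | yes _ = step-map f w Y ws i
  ... | no  _ = refl

  step-below : ∀ {v : B} {Y i} ws → All (i <_) Y → step v Y ws i ≡ v
  step-below []       []            = refl
  step-below (w ∷ ws) []            = refl
  step-below []       (_ ∷ _)       = refl
  step-below {i = i} (w ∷ ws) (_∷_ {y} i<y _) with y ≤? i
  ... | yes y≤i = contradiction y≤i (<⇒≱ i<y)
  ... | no  _   = refl

  step-head : ∀ {v y Y} {w : B} ws → All (y <_) Y → step v (y ∷ Y) (w ∷ ws) y ≡ w
  step-head {y = y} ws y<Y with y ≤? y
  ... | yes _   = step-below ws y<Y
  ... | no  y≰y = contradiction ≤-refl y≰y

  step-repeat : ∀ {v : B} {y Y} ws i → All (y <_) Y → step v (y ∷ Y) (v ∷ ws) i ≡ step v Y ws i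
  step-repeat {y = y} ws i y<Y with y ≤? i
  ... | yes _   = refl
  ... | no  y≰i = sym (step-below ws (All.map (<-trans (≰⇒> y≰i)) y<Y))

module _ {a} {A : Set a} where

  select : List Bool → List A → List A
  select _            []      = []
  select []           (y ∷ Y) = []
  select (true  ∷ bs) (y ∷ Y) = y ∷ select bs Y
  select (false ∷ bs) (y ∷ Y) = select bs Y

  select-⊆ : ∀ bs Y → select bs Y ⊆ Y
  select-⊆ bs           []      = []
  select-⊆ []           (y ∷ Y) = minimum (y ∷ Y)
  select-⊆ (true  ∷ bs) (y ∷ Y) = refl ∷ select-⊆ bs Y
  select-⊆ (false ∷ bs) (y ∷ Y) = y ∷ʳ select-⊆ bs Y

masks : ℕ → ℕ → List (List Bool)
masks zero    zero    = [] ∷ []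
masks zero    (suc k) = []
masks (suc n) zero    = map (false ∷_) (masks n zero)
masks (suc n) (suc k) = map (true ∷_) (masks n k) ++ map (false ∷_) (masks n (suc k))

length-select : ∀ {a} {A : Set a} {n k bs} {Y : List A} → bs ∈ masks n k → n ≤ length Y →
                length (select bs Y) ≡ k
length-select {n = zero}  {zero}  {Y = []}    (here refl) _ = refl
length-select {n = zero}  {zero}  {Y = _ ∷ _} (here refl) _ = refl
length-select {n = suc n} {zero}  {Y = _ ∷ Y} bs∈ (s≤s n≤|Y|) with ∈-map⁻ (false ∷_) bs∈
... | _ , bs∈′ , refl = length-select {Y = Y} bs∈′ n≤|Y|
length-select {n = suc n} {suc k} {Y = _ ∷ Y} bs∈ (s≤s n≤|Y|) with ∈-++⁻ (map (true ∷_) (masks n k)) bs∈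
... | inj₁ bs∈ₜ with ∈-map⁻ (true ∷_) bs∈ₜ
...   | _ , bs∈′ , refl = cong suc (length-select {Y = Y} bs∈′ n≤|Y|)
length-select {n = suc n} {suc k} {Y = _ ∷ Y} bs∈ (s≤s n≤|Y|) | inj₂ bs∈f with ∈-map⁻ (false ∷_) bs∈f
...   | _ , bs∈′ , refl = length-select {Y = Y} bs∈′ n≤|Y|

expand : ∀ {b} {B : Set b} → B → List Bool → List B → List B
expand v (true  ∷ bs) (w ∷ ws) = w ∷ expand w bs ws
expand v (false ∷ bs) ws       = v ∷ expand v bs ws
expand v _            _        = []

step-select : ∀ {b} {B : Set b} {Y} (v : B) bs ws i → AllPairs _<_ Y →
              step v (select bs Y) ws i ≡ step v Y (expand v bs ws) i
step-select {Y = []}    v []           ws       i _ = refl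
step-select {Y = _ ∷ _} v []           ws       i _ = refl
step-select {Y = []}    v (_ ∷ _)      ws       i _ = refl
step-select {Y = _ ∷ _} v (true ∷ bs)  []       i _ = refl
step-select {Y = y ∷ _} v (true ∷ bs)  (w ∷ ws) i (_ ∷ Y↑) with y ≤? i
... | yes _ = step-select w bs ws i Y↑
... | no  _ = refl
step-select {Y = _ ∷ _} v (false ∷ bs) ws       i (y<Y ∷ Y↑) =
  trans (step-select v bs ws i Y↑) (sym (step-repeat (expand v bs ws) i y<Y))

-- Configurations of block words

blockWord : Fin 7 → List Move
blockWord j = rise ∷ tail j
  where
    tail : Fin 7 → List Move
    tail zero                                = stay ∷ stay ∷ stay ∷ stay ∷ []
    tail (suc zero)                          = fall ∷ stay ∷ stay ∷ stay ∷ []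
    tail (suc (suc zero))                    = fall ∷ rise ∷ stay ∷ stay ∷ []
    tail (suc (suc (suc zero)))              = stay ∷ fall ∷ stay ∷ stay ∷ []
    tail (suc (suc (suc (suc zero))))        = stay ∷ rise ∷ stay ∷ stay ∷ []
    tail (suc (suc (suc (suc (suc zero)))))  = fall ∷ rise ∷ fall ∷ stay ∷ []
    tail (suc (suc (suc (suc (suc (suc zero)))))) = stay ∷ rise ∷ fall ∷ stay ∷ []

record Configuration : Set where
  constructor configuration
  field
    blocks : List CoordFun
    words  : List (Fin 7)

open Configuration

-- The edge from a to b of the square with block coordinate functions T moves like the block word j,
-- up to the orientation s, with its five letters starting at the blocks marked by bs.
Realises : List CoordFun → Sq → Sq → Fin 7 × List Bool × Bool → Set
Realises T a b (j , bs , s) = map (moveAlong a b) T ≡ map (orient s) (expand stay bs (blockWord j))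

orientedMasks : List (List Bool × Bool)
orientedMasks = cartesianProduct (masks 7 5) (true ∷ false ∷ [])

Realisable : Configuration → Sq → Sq → Set
Realisable cfg a b = Any (Realises (blocks cfg) a b) (cartesianProduct (words cfg) orientedMasks)

Valid : Configuration → Set
Valid cfg = ∀ a b → a ≢ b → Realisable cfg a b

∀-Sign? : ∀ {p} {P : Sign → Set p} → Decidable P → Dec (∀ s → P s)
∀-Sign? P? = map′ (λ { (p₊ , p₋) pos → p₊ ; (p₊ , p₋) neg → p₋ }) (λ p → p pos , p neg) (P? pos ×-dec P? neg)

∀-Sq? : ∀ {p} {P : Sq → Set p} → Decidable P → Dec (∀ a → P a)
∀-Sq? P? = map′ (λ p (x , y) → p x y) (λ p x y → p (x , y)) (∀-Sign? λ x → ∀-Sign? λ y → P? (x , y))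

_≟Sq_ : DecidableEquality Sq
_≟Sq_ = ×-≡-dec Sign._≟_ Sign._≟_

valid? : Decidable Valid
valid? cfg = ∀-Sq? λ a → ∀-Sq? λ b → ¬? (a ≟Sq b) →-dec Any.any? (realises? a b) _
  where
    realises? : ∀ a b → Decidable (Realises (blocks cfg) a b)
    realises? a b (j , bs , s) = ≡-dec _≟ₘ_ _ _

+x₁ -x₁ +x₂ -x₂ one : CoordFun
+x₁ = var pos zero
-x₁ = var neg zero
+x₂ = var pos (suc zero)
-x₂ = var neg (suc zero)
one = const pos

configurations : List Configuration
configurations =
  configuration (one ∷ +x₁ ∷ +x₂ ∷ one ∷ one ∷ one ∷ one ∷ [])   (# 0 ∷ # 1 ∷ []) ∷
  configuration (one ∷ +x₁ ∷ +x₂ ∷ -x₂ ∷ +x₂ ∷ one ∷ one ∷ [])   (# 0 ∷ # 2 ∷ # 5 ∷ []) ∷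
  configuration (+x₁ ∷ one ∷ +x₂ ∷ -x₁ ∷ one ∷ one ∷ one ∷ [])   (# 0 ∷ # 3 ∷ # 6 ∷ []) ∷
  configuration (one ∷ +x₁ ∷ +x₂ ∷ -x₂ ∷ +x₁ ∷ -x₁ ∷ one ∷ [])   (# 1 ∷ # 5 ∷ # 6 ∷ []) ∷
  configuration (+x₁ ∷ +x₂ ∷ -x₂ ∷ -x₁ ∷ one ∷ one ∷ one ∷ [])   (# 1 ∷ # 3 ∷ # 5 ∷ []) ∷
  configuration (+x₁ ∷ one ∷ +x₂ ∷ one ∷ one ∷ one ∷ one ∷ [])   (# 0 ∷ # 3 ∷ # 4 ∷ []) ∷
  configuration (one ∷ +x₁ ∷ +x₂ ∷ -x₂ ∷ +x₁ ∷ one ∷ one ∷ [])   (# 1 ∷ # 2 ∷ # 4 ∷ []) ∷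
  configuration (+x₁ ∷ +x₂ ∷ -x₁ ∷ -x₂ ∷ one ∷ one ∷ one ∷ [])   (# 1 ∷ # 2 ∷ # 3 ∷ []) ∷
  []

configurations-valid : All Valid configurations
configurations-valid = from-yes (All.all? valid? configurations)

∀-Vec? : ∀ {p k n} {P : Vec (Fin k) n → Set p} → Decidable P → Dec (∀ v → P v)
∀-Vec? {n = zero}  P? = map′ (λ { p [] → p }) (λ p → p []) (P? [])
∀-Vec? {n = suc n} P? =
  map′ (λ { p (x ∷ v) → p x v }) (λ p x v → p (x ∷ v)) (all? λ x → ∀-Vec? λ v → P? (x ∷ v))

configurations-cover : ∀ (κ : Fin 7 → Fin 2) → Any (λ cfg → Monochromatic κ (words cfg)) configurations
configurations-cover κ =
  Any.map (Monochromatic-resp-≗ (lookup∘tabulate κ)) (cover (tabulate κ))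
  where
    cover : ∀ v → Any (λ cfg → Monochromatic (Vec.lookup v) (words cfg)) configurations
    cover = from-yes (∀-Vec? λ v → Any.any? (λ cfg → monochromatic? (Vec.lookup v) (words cfg)) configurations)

MonochromaticSquare : ∀ {n} → Colouring n → Set
MonochromaticSquare {n} χ =
  Σ (Fin n → CoordFun) λ φ →
    Injective₂ (subcubeMap φ) ×
    ∃ λ (c : Fin 2) → ∀ (p q : Sq) → ¬ (p ≡ q) → χ (subcubeMap φ p) (subcubeMap φ q) ≡ c

sourcePoint targetPoint : ∀ {n} → (ℕ → Move) → Point n
sourcePoint g i = source (g (toℕ i))
targetPoint g i = target (g (toℕ i))

moves-sourcePoint-targetPoint : ∀ {n} g (i : Fin n) → moves (sourcePoint g) (targetPoint g) i ≡ g (toℕ i)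
moves-sourcePoint-targetPoint g i = move-source-target (g (toℕ i))

orient-step : ∀ s Y ws i → orient s (step stay Y ws i) ≡ step stay Y (map (orient s) ws) i
orient-step true  = step-map (orient true) stay
orient-step false = step-map (orient false) stay

rises-somewhere : ∀ {n} S {ws} → AllPairs _<_ S → All (_< n) S → 0 < length S →
                  ∃ λ (i : Fin n) → step stay S (rise ∷ ws) (toℕ i) ≡ rise
rises-somewhere (s ∷ S) {ws} (s<S ∷ _) (s<n ∷ _) _ =
  fromℕ< s<n , trans (cong (step stay (s ∷ S) (rise ∷ ws)) (toℕ-fromℕ< s<n)) (step-head ws s<S)

module _ {n} (χ : Colouring n) where

  wordColour : List ℕ → Fin 7 → Fin 2
  wordColour S j = χ (sourcePoint g) (targetPoint g)
    where g = step stay S (blockWord j)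

  module _ (χ-parallel : ParallelInvariant χ) where

    parallel-colour : ∀ {x y x′ y′ : Point n} s → ¬ x ≈P y → ¬ x′ ≈P y′ →
                      (∀ i → moves x y i ≡ orient s (moves x′ y′ i)) → χ x y ≡ χ x′ y′
    parallel-colour {x} {y} {x′} {y′} true  x≉y x′≉y′ moves≡ = χ-parallel x y x′ y′ x≉y x′≉y′ (inj₁ λ i →
      trans (displacement-move (x i) (y i))
            (trans (cong displacement (moves≡ i)) (sym (displacement-move (x′ i) (y′ i)))))
    parallel-colour {x} {y} {x′} {y′} false x≉y x′≉y′ moves≡ = χ-parallel x y x′ y′ x≉y x′≉y′ (inj₂ λ i →
      trans (displacement-move (x i) (y i))
            (trans (cong displacement (moves≡ i))
                   (trans (displacement-flip (moves x′ y′ i)) (cong -_ (sym (displacement-move (x′ i) (y′ i)))))))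

    module _ {Y : List ℕ} (Y↑ : AllPairs _<_ Y) (Y<n : All (_< n) Y) (7≤|Y| : 7 ≤ length Y)
             {κ : Fin 7 → Fin 2} (Y-homogeneous : Homogeneous 5 wordColour Y κ) where

      blockMap : List CoordFun → Fin n → CoordFun
      blockMap T i = step one Y T (toℕ i)

      realised-edge : ∀ T a b j bs s → bs ∈ masks 7 5 → Realises T a b (j , bs , s) →
                      let f = subcubeMap (blockMap T) in χ (f a) (f b) ≡ κ j × ¬ f a ≈P f b
      realised-edge T a b j bs s bs∈ realises = colour , fa≉fb
        where
          f = subcubeMap (blockMap T)
          S = select bs Y
          S⊆Y = select-⊆ bs Y
          |S| : length S ≡ 5
          |S| = length-select {Y = Y} bs∈ 7≤|Y|
          g = step stay S (blockWord j)

          moves≡ : ∀ i → moves (f a) (f b) i ≡ orient s (moves (sourcePoint g) (targetPoint g) i)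
          moves≡ i = begin
            moves (f a) (f b) i                                ≡⟨ step-map (moveAlong a b) one Y T (toℕ i) ⟩
            step stay Y (map (moveAlong a b) T) (toℕ i)        ≡⟨ cong (λ ws → step stay Y ws (toℕ i)) realises ⟩
            step stay Y (map (orient s) (expand stay bs (blockWord j))) (toℕ i)
              ≡⟨ orient-step s Y (expand stay bs (blockWord j)) (toℕ i) ⟨
            orient s (step stay Y (expand stay bs (blockWord j)) (toℕ i))
              ≡⟨ cong (orient s) (step-select stay bs (blockWord j) (toℕ i) Y↑) ⟨
            orient s (g (toℕ i))                               ≡⟨ cong (orient s) (moves-sourcePoint-targetPoint g i) ⟨
            orient s (moves (sourcePoint g) (targetPoint g) i) ∎
            where open ≡-Reasoning

          rise-point = rises-somewhere S (AllPairs-resp-⊆ S⊆Y Y↑) (All-resp-⊆ S⊆Y Y<n)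
                         (subst (0 <_) (sym |S|) (s≤s z≤n))
          i₀ = proj₁ rise-point

          g-moves : moves (sourcePoint {n} g) (targetPoint g) i₀ ≡ rise
          g-moves = trans (moves-sourcePoint-targetPoint g i₀) (proj₂ rise-point)

          source≉target : ¬ sourcePoint g ≈P targetPoint g
          source≉target = moves-≢-stay i₀ λ moves≡stay → case (trans (sym g-moves) moves≡stay) of λ ()

          fa≉fb : ¬ f a ≈P f b
          fa≉fb = moves-≢-stay i₀ λ moves≡stay →
            orient-≢-stay s (λ ()) (trans (sym (cong (orient s) g-moves)) (trans (sym (moves≡ i₀)) moves≡stay))

          colour : χ (f a) (f b) ≡ κ j
          colour = trans (parallel-colour s fa≉fb source≉target moves≡) (Y-homogeneous S⊆Y |S| j)

      subcube : ∀ {cfg} → Valid cfg → Monochromatic κ (words cfg) → MonochromaticSquare χ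
      subcube {cfg} valid (c , κ≡c) = blockMap (blocks cfg) , injective , c , λ a b a≢b → proj₁ (edge a b a≢b)
        where
          f = subcubeMap (blockMap (blocks cfg))

          edge : ∀ a b → a ≢ b → χ (f a) (f b) ≡ c × ¬ f a ≈P f b
          edge a b a≢b with find (valid a b a≢b)
          ... | (j , bs , s) , t∈ , realises with ∈-cartesianProduct⁻ (words cfg) orientedMasks t∈
          ... | j∈ , bs,s∈ with realised-edge (blocks cfg) a b j bs s
                                  (proj₁ (∈-cartesianProduct⁻ (masks 7 5) (true ∷ false ∷ []) bs,s∈)) realises
          ... | colour , fa≉fb = trans colour (All.lookup κ≡c j∈) , fa≉fb

          injective : Injective₂ f
          injective a b fa≈fb with a ≟Sq b
          ... | yes a≡b = a≡b
          ... | no  a≢b = contradiction fa≈fb (proj₂ (edge a b a≢b))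

monochromatic-square : ∀ {n} → ramseyBound 7 7 5 ≤ n → (χ : Colouring n) → ParallelInvariant χ →
                       MonochromaticSquare χ
monochromatic-square {n} n-large χ χ-parallel = fromHomogeneous
  (ramsey 7 5 (wordColour χ) (upTo n) (subst (ramseyBound 7 7 5 ≤_) (sym (length-upTo n)) n-large))
  where
    fromHomogeneous : (∃ λ Y → Y ⊆ upTo n × 7 ≤ length Y × ∃ (Homogeneous 5 (wordColour χ) Y)) → MonochromaticSquare χ
    -- cfg is passed explicitly: solving for it would make Agda unfold Valid and evaluate the search.
    fromHomogeneous (Y , Y⊆upTo , 7≤|Y| , κ , Y-homogeneous) =
      let (cfg , cfg∈ , κ-monochromatic) = find (configurations-cover κ)
      in subcube χ χ-parallel (AllPairs-resp-⊆ Y⊆upTo (applyUpTo⁺₁ id n λ i<j _ → i<j))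
           (All-resp-⊆ Y⊆upTo (all-upTo n)) 7≤|Y| Y-homogeneous {cfg} (All.lookup configurations-valid cfg∈) κ-monochromatic

lemma2p3 : (χ : Colouring (2 ↑↑ 18)) → ParallelInvariant χ →
    Σ (Fin (2 ↑↑ 18) → CoordFun) λ φ →
      Injective₂ (subcubeMap φ) ×
      ∃ λ (c : Fin 2) → ∀ (p q : Sq) → ¬ (p ≡ q) →
        χ (subcubeMap φ p) (subcubeMap φ q) ≡ c
-- The heights are explicit so that Agda never has to evaluate 2 ↑↑ 18 while unifying.
lemma2p3 = monochromatic-square (ramseyBound-≤-↑↑ {5} {18} (≤⇒≤′ (m≤m+n 13 5)))
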